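{- Let $\mathbb{F}$ be a field, let $n\ge1$ and $m\ge s\ge1$, and let $\epsilon<1$. If $f:\mathbb{F}^n\times\mathbb{F}^m\to\mathbb{F}^t$ is a bilinear $(1,s,\epsilon)$-two-source rank condenser, then $t\ge m-\epsilon s$.
   Context: A function $f:\mathbb{F}^n\times\mathbb{F}^m\to\mathbb{F}^t$ is an $(r,s,\epsilon)$-two-source rank condenser if for all sets $A\subseteq\mathbb{F}^n$, $B\subseteq\mathbb{F}^m$ with $\mathrm{rank}\,A=r$ and $\mathrm{rank}\,B=s$, the set $f(A\times B)=\{f(v,w)\}_{v\in A,w\in B}$ has rank at least $(1-\epsilon)rs$. It is bilinear if $f(v,w)=(v^{\mathrm{tr}}E_iw)_{i=1}^t$ for some matrices $E_i\in\mathbb{F}^{n\times m}$.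
   Formalization: The parameter ε takes rational values. -}

module Defs where

open import Level using (Level; _⊔_; suc)
open import Algebra.Bundles using (CommutativeRing)
open import Data.Nat.Base as ℕ using (ℕ)
open import Data.Fin.Base using (Fin)
open import Data.Product using (Σ; ∃; _×_; _,_)
open import Data.Integer.Base using (+_)
open import Data.Rational.Base as ℚ using (ℚ; _/_)
open import Relation.Nullary using (¬_)
open import Relation.Unary using (Pred; _∈_)
import Algebra.Properties.Monoid.Sum as MonoidSum

ℕ→ℚ : ℕ → ℚ
ℕ→ℚ n = + n / 1

module _ {c ℓ : Level} (R : CommutativeRing c ℓ) where
  open CommutativeRing R
  open MonoidSum +-monoid using (sum)

  record IsField : Set (c ⊔ ℓ) where
    field
      0≉1     : ¬ (0# ≈ 1#)
      inverse : ∀ x → ¬ (x ≈ 0#) → Σ Carrier λ y → (x * y) ≈ 1#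

  Vec𝔽 : ℕ → Set c
  Vec𝔽 n = Fin n → Carrier

  LinIndep : ∀ {k n} → (Fin k → Vec𝔽 n) → Set (c ⊔ ℓ)
  LinIndep {k} {n} v =
    (a : Fin k → Carrier) →
    (∀ j → sum (λ i → a i * v i j) ≈ 0#) →
    ∀ i → a i ≈ 0#

  VSet : ℕ → Set (suc (c ⊔ ℓ))
  VSet n = Pred (Vec𝔽 n) (c ⊔ ℓ)

  RankAtLeast : ∀ {n} → VSet n → ℕ → Set (c ⊔ ℓ)
  RankAtLeast {n} A k =
    Σ (Fin k → Vec𝔽 n) λ v → (∀ i → v i ∈ A) × LinIndep v

  -- rank A = r  (rank = maximal size of a linearly independent subset = dim span)
  HasRank : ∀ {n} → VSet n → ℕ → Set (c ⊔ ℓ)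
  HasRank A r = RankAtLeast A r × ¬ RankAtLeast A (ℕ.suc r)

  ImageRankAtLeast : ∀ {n m t} → (Vec𝔽 n → Vec𝔽 m → Vec𝔽 t) →
                     VSet n → VSet m → ℕ → Set (c ⊔ ℓ)
  ImageRankAtLeast {n} {m} {t} f A B k =
    Σ (Fin k → Vec𝔽 n) λ v → Σ (Fin k → Vec𝔽 m) λ w →
      (∀ i → v i ∈ A) × (∀ i → w i ∈ B) × LinIndep (λ i → f (v i) (w i))

  IsTwoSourceRankCondenser : ∀ {n m t} → (Vec𝔽 n → Vec𝔽 m → Vec𝔽 t) →
                             ℕ → ℕ → ℚ → Set (suc (c ⊔ ℓ))
  IsTwoSourceRankCondenser {n} {m} f r s ε =
    (A : VSet n) (B : VSet m) → HasRank A r → HasRank B s →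
    Σ ℕ λ k → ((ℚ.1ℚ ℚ.- ε) ℚ.* ℕ→ℚ r ℚ.* ℕ→ℚ s) ℚ.≤ ℕ→ℚ k × ImageRankAtLeast f A B k

  IsBilinear : ∀ {n m t} → (Vec𝔽 n → Vec𝔽 m → Vec𝔽 t) → Set (c ⊔ ℓ)
  IsBilinear {n} {m} {t} f =
    Σ (Fin t → Fin n → Fin m → Carrier) λ E →
      ∀ v w i → f v w i ≈ sum (λ j → sum (λ l → v j * E i j l * w l))

module Submission where

-- With e₀ the first unit vector, x ↦ f(e₀, x) is t linear functionals on 𝔽ᵐ.
-- Gaussian elimination gives m vectors in echelon form, K in the common kernel
-- and E = m − K ≤ t pivots.  Take A = {e₀} (rank 1) and B = min(K, s) kernel
-- vectors plus s ∸ K pivot vectors (rank s).  Independent families in f(A × B)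
-- avoid the kernel vectors and repeat nothing, so the condenser property gives
-- (1 − ε)s ≤ s ∸ K; since ε < 1 this means K < s and K ≤ εs, so m ≤ εs + t.
-- Elimination needs to decide whether field elements vanish, so the echelon
-- basis exists only under a double negation, removed at the end since the
-- conclusion is decidable.

open import Defs
open import Level using (Level; _⊔_; Lift; lift; lower)
open import Algebra.Bundles using (CommutativeRing)
open import Function.Base using (_∘_)
open import Function.Definitions using (Injective)
open import Data.Bool.Base using (Bool; true; false)
open import Data.Nat.Base as ℕ using (ℕ; zero; suc; _∸_)
open import Data.Fin.Base using (Fin; zero; suc; punchIn; splitAt; _↑ˡ_; _↑ʳ_; inject≤)
open import Data.Fin.Properties
  using (_≟_; punchInᵢ≢i; suc-injective; injective⇒≤; inject≤-injective; splitAt⁻¹-↑ˡ; splitAt⁻¹-↑ʳ)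
open import Data.Vec.Functional using (updateAt; _++_)
open import Data.Vec.Functional.Properties using (updateAt-updates; updateAt-minimal; lookup-++ˡ; lookup-++ʳ)
import Data.Nat.Properties as ℕ
open import Data.Product.Base using (∃; _×_; _,_; proj₁; proj₂)
open import Data.Sum.Base using (_⊎_; inj₁; inj₂)
open import Data.Empty using (⊥-elim)
open import Relation.Nullary.Negation.Core using (¬_; contradiction)
open import Relation.Nullary.Decidable.Core using (Dec; yes; no; decidable-stable)
open import Relation.Binary.PropositionalEquality as ≡ using (_≡_; _≢_)

¬¬-∀-Fin : ∀ {a} n {P : Fin n → Set a} → (∀ i → ¬ ¬ P i) → ¬ ¬ (∀ i → P i)
¬¬-∀-Fin zero    h k = k λ ()
¬¬-∀-Fin (suc n) h k = h zero λ p₀ → ¬¬-∀-Fin n (h ∘ suc) λ ps → k λ { zero → p₀ ; (suc i) → ps i }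

¬¬-all-or-counterexample : ∀ {a b} n {Q : Fin n → Set a} {Z : Fin n → Set b} →
                           ¬ ¬ ((∀ i → Q i → Z i) ⊎ ∃ λ i → Q i × ¬ Z i)
¬¬-all-or-counterexample n k = ¬¬-∀-Fin n
  (λ i ¬qz → ¬qz λ qᵢ → ⊥-elim (k (inj₂ (i , qᵢ , λ zᵢ → ¬qz λ _ → zᵢ))))
  (k ∘ inj₁)

module ℕ→ℚ-Arithmetic where
  open import Relation.Binary.PropositionalEquality
    using (_≡_; refl; cong; cong₂; sym; trans; subst; subst₂; module ≡-Reasoning)
  open import Data.Integer.Base as ℤ using (+_)
  import Data.Integer.Properties as ℤ
  open import Data.Rational.Base
  open import Data.Rational.Properties
  open import Data.Rational.Solver using (module +-*-Solver)
  open import Data.Rational.Unnormalised.Base using (*≡*)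
  open import Data.Rational.Unnormalised.Properties using () renaming (≃-trans to ≃ᵘ-trans; ≃-sym to ≃ᵘ-sym)
  open import Data.Nat.Coprimality using (1-coprimeTo) renaming (sym to coprime-sym)

  normal : ℕ → ℚ
  normal n = mkℚ (+ n) 0 (coprime-sym (1-coprimeTo n))

  ℕ→ℚ-normal : ∀ n → ℕ→ℚ n ≡ normal n
  ℕ→ℚ-normal n = ↥p/↧p≡p (normal n)

  ℕ→ℚ-mono-≤ : ∀ {a b} → a ℕ.≤ b → ℕ→ℚ a ≤ ℕ→ℚ b
  ℕ→ℚ-mono-≤ {a} {b} a≤b rewrite ℕ→ℚ-normal a | ℕ→ℚ-normal b =
    *≤* (subst₂ ℤ._≤_ (sym (ℤ.*-identityʳ (+ a))) (sym (ℤ.*-identityʳ (+ b))) (ℤ.+≤+ a≤b))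

  ℕ→ℚ-+ : ∀ a b → ℕ→ℚ (a ℕ.+ b) ≡ ℕ→ℚ a + ℕ→ℚ b
  ℕ→ℚ-+ a b rewrite ℕ→ℚ-normal (a ℕ.+ b) | ℕ→ℚ-normal a | ℕ→ℚ-normal b =
    toℚᵘ-injective (≃ᵘ-trans (*≡* cross) (≃ᵘ-sym (toℚᵘ-homo-+ (normal a) (normal b))))
    where
    open ≡-Reasoning
    -- the cross-multiplied form of (a + b)/1 = a/1 + b/1
    cross : + (a ℕ.+ b) ℤ.* + 1 ≡ (+ a ℤ.* + 1 ℤ.+ + b ℤ.* + 1) ℤ.* + 1
    cross = begin
      + (a ℕ.+ b) ℤ.* + 1                   ≡⟨ ℤ.*-identityʳ _ ⟩
      + (a ℕ.+ b)                           ≡⟨ ℤ.pos-+ a b ⟩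
      + a ℤ.+ + b                           ≡⟨ cong₂ ℤ._+_ (ℤ.*-identityʳ (+ a)) (ℤ.*-identityʳ (+ b)) ⟨
      + a ℤ.* + 1 ℤ.+ + b ℤ.* + 1           ≡⟨ ℤ.*-identityʳ _ ⟨
      (+ a ℤ.* + 1 ℤ.+ + b ℤ.* + 1) ℤ.* + 1 ∎

  1-ε*s-positive : ∀ ε s → ε < 1ℚ → 1 ℕ.≤ s → 0ℚ < (1ℚ - ε) * ℕ→ℚ 1 * ℕ→ℚ s
  1-ε*s-positive ε s ε<1 1≤s = subst (λ x → 0ℚ < x * ℕ→ℚ s) (sym (*-identityʳ (1ℚ - ε)))
    (positive⁻¹ _ {{pos*pos⇒pos (1ℚ - ε) {{positive 1-ε>0}} (ℕ→ℚ s) {{positive s>0}}}})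
    where
    1-ε>0 : 0ℚ < 1ℚ - ε
    1-ε>0 = subst (_< 1ℚ - ε) (+-inverseʳ ε) (+-monoˡ-< (- ε) ε<1)
    s>0 : 0ℚ < ℕ→ℚ s
    s>0 = <-≤-trans (*<* (ℤ.+<+ (ℕ.s≤s ℕ.z≤n))) (ℕ→ℚ-mono-≤ 1≤s)

  -- The arithmetic of the final step: if ε < 1 ≤ s, (1 − ε)s ≤ s ∸ K and
  -- m ≤ K + t, then m − εs ≤ t.  The first three hypotheses force K < s, and
  -- then (1 − ε)s ≤ s − K says exactly K ≤ εs.
  condensing-arithmetic : ∀ ε (m s K t : ℕ) → ε < 1ℚ → 1 ℕ.≤ s →
    (1ℚ - ε) * ℕ→ℚ 1 * ℕ→ℚ s ≤ ℕ→ℚ (s ∸ K) → m ℕ.≤ K ℕ.+ t →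
    ℕ→ℚ m - ε * ℕ→ℚ s ≤ ℕ→ℚ t
  condensing-arithmetic ε m s K t ε<1 1≤s condensed m≤K+t with K ℕ.≤? s
  ... | no K≰s = ⊥-elim (<-irrefl refl (<-≤-trans (1-ε*s-positive ε s ε<1 1≤s) condensed-to-0))
    where
    condensed-to-0 : (1ℚ - ε) * ℕ→ℚ 1 * ℕ→ℚ s ≤ 0ℚ
    condensed-to-0 = subst (λ r → (1ℚ - ε) * ℕ→ℚ 1 * ℕ→ℚ s ≤ ℕ→ℚ r) (ℕ.m≤n⇒m∸n≡0 (ℕ.<⇒≤ (ℕ.≰⇒> K≰s))) condensed
  ... | yes K≤s = begin
    M - ε * S                          ≤⟨ +-monoˡ-≤ (- (ε * S)) M≤K+T ⟩
    (K′ + T) - ε * S                   ≡⟨ cong (λ x → (K′ + T) - ε * x) S≡R+K ⟩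
    (K′ + T) - ε * (R + K′)            ≡⟨ regroup ε R K′ T ⟩
    T + ((1ℚ - ε) * 1ℚ * (R + K′) - R) ≤⟨ +-monoʳ-≤ T slack≤0 ⟩
    T + 0ℚ                             ≡⟨ +-identityʳ T ⟩
    T                                  ∎
    where
    open ≤-Reasoning
    open +-*-Solver
    M S R K′ T : ℚ
    M = ℕ→ℚ m ; S = ℕ→ℚ s ; R = ℕ→ℚ (s ∸ K) ; K′ = ℕ→ℚ K ; T = ℕ→ℚ t
    S≡R+K : S ≡ R + K′
    S≡R+K = trans (cong ℕ→ℚ (sym (ℕ.m∸n+n≡m K≤s))) (ℕ→ℚ-+ (s ∸ K) K)
    M≤K+T : M ≤ K′ + T
    M≤K+T = subst (M ≤_) (ℕ→ℚ-+ K t) (ℕ→ℚ-mono-≤ m≤K+t)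
    regroup : ∀ e r k u → (k + u) - e * (r + k) ≡ u + ((1ℚ - e) * 1ℚ * (r + k) - r)
    regroup = solve 4 (λ e r k u → (k :+ u) :- e :* (r :+ k) := u :+ ((con 1ℚ :- e) :* con 1ℚ :* (r :+ k) :- r)) refl
    slack≤0 : (1ℚ - ε) * 1ℚ * (R + K′) - R ≤ 0ℚ
    slack≤0 = subst ((1ℚ - ε) * 1ℚ * (R + K′) - R ≤_) (+-inverseʳ R)
                (+-monoˡ-≤ (- R) (subst (λ x → (1ℚ - ε) * 1ℚ * x ≤ R) S≡R+K condensed))

weight : Bool → ℕ
weight true  = 0
weight false = 1

count-false : ∀ {m} → (Fin m → Bool) → ℕ
count-false {zero}  c = 0
count-false {suc m} c = weight (c zero) ℕ.+ count-false (c ∘ suc)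

count-false-const-true : ∀ m → count-false {m} (λ _ → true) ≡ 0
count-false-const-true zero    = ≡.refl
count-false-const-true (suc m) = count-false-const-true m

count-false-head : ∀ {m} {c : Fin (suc m) → Bool} {b} → c zero ≡ b →
                   weight b ℕ.+ count-false (c ∘ suc) ≡ count-false c
count-false-head c₀ rewrite c₀ = ≡.refl

count-false-recolour : ∀ {m} (c : Fin m → Bool) p → c p ≡ true →
                       count-false (updateAt c p (λ _ → false)) ≡ suc (count-false c)
count-false-recolour c zero    cp≡true rewrite cp≡true = ≡.refl
count-false-recolour c (suc p) cp≡true rewrite count-false-recolour (c ∘ suc) p cp≡true =
  ℕ.+-suc (weight (c zero)) _

record Listing {m} (c : Fin m → Bool) (b : Bool) (k : ℕ) : Set where
  field
    point           : Fin k → Fin m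
    point-injective : Injective _≡_ _≡_ point
    point-colour    : ∀ i → c (point i) ≡ b

shift : ∀ {m c b k} → Listing {m} (c ∘ suc) b k → Listing c b k
shift L = record
  { point = suc ∘ point ; point-injective = point-injective ∘ suc-injective ; point-colour = point-colour }
  where open Listing L

extend : ∀ {m c b k} → c zero ≡ b → Listing {m} (c ∘ suc) b k → Listing c b (suc k)
extend {c = c} {b} {k} c₀ L = record { point = point′ ; point-injective = injective ; point-colour = colour }
  where
  open Listing L
  point′ : Fin (suc k) → Fin _
  point′ zero    = zero
  point′ (suc i) = suc (point i)
  injective : Injective _≡_ _≡_ point′
  injective {zero}  {zero}  _ = ≡.refl
  injective {suc i} {suc j} e = ≡.cong suc (point-injective (suc-injective e))
  colour : ∀ i → c (point′ i) ≡ b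
  colour zero    = c₀
  colour (suc i) = point-colour i

record Split {m} (c : Fin m → Bool) : Set where
  field
    K E     : ℕ
    K+E≡m   : K ℕ.+ E ≡ m
    E≡count : E ≡ count-false c
    trues   : Listing c true K
    falses  : Listing c false E

split : ∀ {m} (c : Fin m → Bool) → Split c
split {zero} c = record
  { K = 0 ; E = 0 ; K+E≡m = ≡.refl ; E≡count = ≡.refl
  ; trues = empty ; falses = empty }
  where
  empty : ∀ {b} → Listing c b 0
  empty = record { point = λ () ; point-injective = λ {} ; point-colour = λ () }
split {suc m} c with split (c ∘ suc) | c zero in c₀
... | S | true  = record
  { K = suc K ; E = E ; K+E≡m = ≡.cong suc K+E≡m ; E≡count = ≡.trans E≡count (count-false-head {c = c} c₀)
  ; trues = extend c₀ trues ; falses = shift falses }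
  where open Split S
... | S | false = record
  { K = K ; E = suc E ; K+E≡m = ≡.trans (ℕ.+-suc K E) (≡.cong suc K+E≡m)
  ; E≡count = ≡.trans (≡.cong suc E≡count) (count-false-head {c = c} c₀)
  ; trues = shift trues ; falses = extend c₀ falses }
  where open Split S

block : ∀ d {r} (i : Fin (d ℕ.+ r)) → (∃ λ a → a ↑ˡ r ≡ i) ⊎ (∃ λ b → d ↑ʳ b ≡ i)
block d i with splitAt d i in split-i
... | inj₁ a = inj₁ (a , splitAt⁻¹-↑ˡ split-i)
... | inj₂ b = inj₂ (b , splitAt⁻¹-↑ʳ split-i)

++-injective : ∀ {a} {X : Set a} {d r} (u : Fin d → X) (v : Fin r → X) →
               Injective _≡_ _≡_ u → Injective _≡_ _≡_ v → (∀ i j → u i ≢ v j) →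
               Injective _≡_ _≡_ (u ++ v)
++-injective {d = d} {r} u v u-inj v-inj disjoint {i} {j} same with block d i | block d j
... | inj₁ (a , ≡.refl) | inj₁ (b , ≡.refl) =
  ≡.cong (_↑ˡ r) (u-inj (≡.trans (≡.sym (lookup-++ˡ u v a)) (≡.trans same (lookup-++ˡ u v b))))
... | inj₂ (a , ≡.refl) | inj₂ (b , ≡.refl) =
  ≡.cong (d ↑ʳ_) (v-inj (≡.trans (≡.sym (lookup-++ʳ u v a)) (≡.trans same (lookup-++ʳ u v b))))
... | inj₁ (a , ≡.refl) | inj₂ (b , ≡.refl) =
  contradiction (≡.trans (≡.sym (lookup-++ˡ u v a)) (≡.trans same (lookup-++ʳ u v b))) (disjoint a b)
... | inj₂ (a , ≡.refl) | inj₁ (b , ≡.refl) =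
  contradiction (≡.trans (≡.sym (lookup-++ˡ u v b)) (≡.trans (≡.sym same) (lookup-++ʳ u v a))) (disjoint b a)

module LinearAlgebra {c ℓ : Level} (F : CommutativeRing c ℓ) (isField : IsField F) where
  open CommutativeRing F hiding (zero)
  open import Algebra.Properties.Semiring.Sum semiring
    using (sum; sum-cong-≋; sum-replicate-zero; sum-remove; ∑-distrib-+; *-distribˡ-sum)
  open import Algebra.Properties.Ring ring using (-‿distribˡ-*; -‿distribʳ-*)
  open import Algebra.Properties.Group +-group using (x≈y⇒x∙y⁻¹≈ε; ε⁻¹≈ε)
  open import Algebra.Properties.CommutativeSemigroup *-commutativeSemigroup using (x∙yz≈y∙xz)
  open import Relation.Binary.Reasoning.Setoid setoid
  open IsField isField using (0≉1; inverse)

  sum-zero : ∀ {n} (g : Fin n → Carrier) → (∀ l → g l ≈ 0#) → sum g ≈ 0#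
  sum-zero {n} g g≈0 = trans (sum-cong-≋ g≈0) (sum-replicate-zero n)

  sum-single : ∀ {n} (g : Fin n → Carrier) i → (∀ l → l ≢ i → g l ≈ 0#) → sum g ≈ g i
  sum-single {suc n} g i others≈0 = begin
    sum g                             ≈⟨ sum-remove g ⟩
    g i + sum (λ l → g (punchIn i l))  ≈⟨ +-congˡ (sum-zero _ λ l → others≈0 _ (punchInᵢ≢i i l)) ⟩
    g i + 0#                          ≈⟨ +-identityʳ (g i) ⟩
    g i                               ∎

  sum-linear : ∀ {n} (x y : Fin n → Carrier) k → sum (λ l → x l - k * y l) ≈ sum x - k * sum y
  sum-linear x y k = begin
    sum (λ l → x l - k * y l)        ≈⟨ ∑-distrib-+ x (λ l → - (k * y l)) ⟩
    sum x + sum (λ l → - (k * y l))  ≈⟨ +-congˡ (sum-cong-≋ λ l → -‿distribˡ-* k (y l)) ⟩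
    sum x + sum (λ l → - k * y l)    ≈⟨ +-congˡ (*-distribˡ-sum (- k) y) ⟨
    sum x + - k * sum y              ≈⟨ +-congˡ (-‿distribˡ-* k (sum y)) ⟨
    sum x - k * sum y                ∎

  *-distribʳ-minus : ∀ a u b x → (a - u * b) * x ≈ a * x - u * (b * x)
  *-distribʳ-minus a u b x = begin
    (a - u * b) * x          ≈⟨ distribʳ x a (- (u * b)) ⟩
    a * x + - (u * b) * x    ≈⟨ +-congˡ (-‿distribˡ-* (u * b) x) ⟨
    a * x - (u * b) * x      ≈⟨ +-congˡ (-‿cong (*-assoc u b x)) ⟩
    a * x - u * (b * x)      ∎

  *-distribˡ-minus : ∀ a x u y → a * (x - u * y) ≈ a * x - u * (a * y)
  *-distribˡ-minus a x u y = begin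
    a * (x - u * y)          ≈⟨ distribˡ a x (- (u * y)) ⟩
    a * x + a * - (u * y)    ≈⟨ +-congˡ (-‿distribʳ-* a (u * y)) ⟨
    a * x - a * (u * y)      ≈⟨ +-congˡ (-‿cong (x∙yz≈y∙xz a u y)) ⟩
    a * x - u * (a * y)      ∎

  minus-scaled-zero : ∀ x u {y} → y ≈ 0# → x - u * y ≈ x
  minus-scaled-zero x u {y} y≈0 = begin
    x - u * y  ≈⟨ +-congˡ (-‿cong (trans (*-congˡ y≈0) (zeroʳ u))) ⟩
    x - 0#     ≈⟨ +-congˡ ε⁻¹≈ε ⟩
    x + 0#     ≈⟨ +-identityʳ x ⟩
    x          ∎

  minus-zeros : ∀ {x y} u → x ≈ 0# → y ≈ 0# → x - u * y ≈ 0#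
  minus-zeros {x} u x≈0 y≈0 = trans (minus-scaled-zero x u y≈0) x≈0

  e : ∀ {m} → Fin m → Vec𝔽 F m
  e zero    zero    = 1#
  e zero    (suc _) = 0#
  e (suc _) zero    = 0#
  e (suc i) (suc j) = e i j

  e-diag : ∀ {m} (i : Fin m) → e i i ≈ 1#
  e-diag zero    = refl
  e-diag (suc i) = e-diag i

  e-off : ∀ {m} (i j : Fin m) → i ≢ j → e i j ≈ 0#
  e-off zero    zero    i≢j = contradiction ≡.refl i≢j
  e-off zero    (suc j) _   = refl
  e-off (suc i) zero    _   = refl
  e-off (suc i) (suc j) i≢j = e-off i j (i≢j ∘ ≡.cong suc)

  sum-e : ∀ {k} (g : Fin k → Carrier) i → sum (λ l → e i l * g l) ≈ g i
  sum-e g i = begin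
    sum (λ l → e i l * g l) ≈⟨ sum-single _ i (λ l l≢i → trans (*-congʳ (e-off i l (l≢i ∘ ≡.sym))) (zeroˡ _)) ⟩
    e i i * g i             ≈⟨ *-congʳ (e-diag i) ⟩
    1# * g i                ≈⟨ *-identityˡ (g i) ⟩
    g i                     ∎

  1≉0 : ¬ (1# ≈ 0#)
  1≉0 1≈0 = 0≉1 (sym 1≈0)

  independent⇒nonzero : ∀ {k N} {x : Fin k → Vec𝔽 F N} → LinIndep F x → ∀ i → ¬ (∀ j → x i j ≈ 0#)
  independent⇒nonzero {x = x} indep i xᵢ≈0 = 1≉0 (begin
    1#      ≈⟨ e-diag i ⟨
    e i i   ≈⟨ indep (e i) (λ j → trans (sum-e (λ l → x l j) i) (xᵢ≈0 j)) i ⟩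
    0#      ∎)

  independent⇒injective : ∀ {k N} {x : Fin k → Vec𝔽 F N} → LinIndep F x →
                          ∀ i j → (∀ l → x i l ≈ x j l) → i ≡ j
  independent⇒injective {k} {x = x} indep i j xᵢ≈xⱼ with i ≟ j
  ... | yes i≡j = i≡j
  ... | no  i≢j = ⊥-elim (1≉0 (trans (sym aᵢ≈1) (indep a combination≈0 i)))
    where
    a : Fin k → Carrier
    a l = e i l - 1# * e j l
    combination≈0 : ∀ c → sum (λ l → a l * x l c) ≈ 0#
    combination≈0 c = begin
      sum (λ l → a l * x l c)                                   ≈⟨ sum-cong-≋ (λ l → *-distribʳ-minus (e i l) 1# (e j l) (x l c)) ⟩
      sum (λ l → e i l * x l c - 1# * (e j l * x l c))          ≈⟨ sum-linear (λ l → e i l * x l c) (λ l → e j l * x l c) 1# ⟩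
      sum (λ l → e i l * x l c) - 1# * sum (λ l → e j l * x l c) ≈⟨ +-cong (sum-e _ i) (-‿cong (*-congˡ (sum-e _ j))) ⟩
      x i c - 1# * x j c                                         ≈⟨ x≈y⇒x∙y⁻¹≈ε (trans (xᵢ≈xⱼ c) (sym (*-identityˡ _))) ⟩
      0#                                                         ∎
    aᵢ≈1 : a i ≈ 1#
    aᵢ≈1 = trans (minus-scaled-zero (e i i) 1# (e-off j i (i≢j ∘ ≡.sym))) (e-diag i)

  -- Each W a has a pivot coordinate κ a
  -- where it equals 1, and a sort.  If W a vanishes at the pivot of every other
  -- vector of sort true, and at every other pivot when W a itself has sort
  -- false, then the family is independent: read off the coefficients at the
  -- pivots, first those of sort true, then those of sort false.
  echelon-independent : ∀ {s m} (W : Fin s → Vec𝔽 F m) (κ : Fin s → Fin m) (sort : Fin s → Bool) →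
    (∀ a → W a (κ a) ≈ 1#) →
    (∀ a b → a ≢ b → sort b ≡ true ⊎ sort a ≡ false → W a (κ b) ≈ 0#) →
    LinIndep F W
  echelon-independent {s} W κ sort pivot off-pivot a combination≈0 = coefficient≈0
    where
    isolated : ∀ b → (∀ l → l ≢ b → a l * W l (κ b) ≈ 0#) → a b ≈ 0#
    isolated b others≈0 = begin
      a b                           ≈⟨ *-identityʳ (a b) ⟨
      a b * 1#                      ≈⟨ *-congˡ (pivot b) ⟨
      a b * W b (κ b)               ≈⟨ sum-single (λ l → a l * W l (κ b)) b others≈0 ⟨
      sum (λ l → a l * W l (κ b))   ≈⟨ combination≈0 (κ b) ⟩
      0#                            ∎
    true-coefficient≈0 : ∀ b → sort b ≡ true → a b ≈ 0#
    true-coefficient≈0 b sort-b = isolated b λ l l≢b →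
      trans (*-congˡ (off-pivot l b l≢b (inj₁ sort-b))) (zeroʳ (a l))
    coefficient≈0 : ∀ b → a b ≈ 0#
    coefficient≈0 b with sort b in sort-b
    ... | true  = true-coefficient≈0 b sort-b
    ... | false = isolated b others≈0
      where
      others≈0 : ∀ l → l ≢ b → a l * W l (κ b) ≈ 0#
      others≈0 l l≢b with sort l in sort-l
      ... | true  = trans (*-congʳ (true-coefficient≈0 l sort-l)) (zeroˡ _)
      ... | false = trans (*-congˡ (off-pivot l b l≢b (inj₂ sort-l))) (zeroʳ (a l))

  -- Linearity in the form used by elimination: φ (x − g·y) = φ x − g·φ y.
  IsLinear : ∀ {m} → (Vec𝔽 F m → Carrier) → Set (c ⊔ ℓ)
  IsLinear φ = ∀ x y g → φ (λ l → x l - g * y l) ≈ φ x - g * φ y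

  pairing-linear : ∀ {m} (a : Vec𝔽 F m) → IsLinear (λ x → sum (λ l → a l * x l))
  pairing-linear a x y g = begin
    sum (λ l → a l * (x l - g * y l))                 ≈⟨ sum-cong-≋ (λ l → *-distribˡ-minus (a l) (x l) g (y l)) ⟩
    sum (λ l → a l * x l - g * (a l * y l))           ≈⟨ sum-linear (λ l → a l * x l) (λ l → a l * y l) g ⟩
    sum (λ l → a l * x l) - g * sum (λ l → a l * y l) ∎

  sum-of-linear : ∀ {m n} (φ : Fin n → Vec𝔽 F m → Carrier) → (∀ j → IsLinear (φ j)) →
                  IsLinear (λ x → sum (λ j → φ j x))
  sum-of-linear φ linear x y g = begin
    sum (λ j → φ j (λ l → x l - g * y l))     ≈⟨ sum-cong-≋ (λ j → linear j x y g) ⟩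
    sum (λ j → φ j x - g * φ j y)             ≈⟨ sum-linear (λ j → φ j x) (λ j → φ j y) g ⟩
    sum (λ j → φ j x) - g * sum (λ j → φ j y) ∎

  -- By the echelon criterion every subfamily of the w i is independent;
  -- at most t of them are pivots, so at least m − t lie in the common kernel.
  record KernelBasis {m t} (φ : Fin t → Vec𝔽 F m → Carrier) : Set (c ⊔ ℓ) where
    field
      w           : Fin m → Vec𝔽 F m
      inKernel    : Fin m → Bool
      diag        : ∀ i → w i i ≈ 1#
      off-diag    : ∀ i j → i ≢ j → inKernel j ≡ true ⊎ inKernel i ≡ false → w i j ≈ 0#
      annihilated : ∀ k i → inKernel i ≡ true → φ k (w i) ≈ 0#
      few-pivots  : count-false inKernel ℕ.≤ t

  open KernelBasis

  -- Given a kernel basis for φ ∘ suc and a kernel vector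
  -- w p on which the new functional ψ = φ zero does not vanish, p becomes a pivot
  -- with vector e p, and ψ is cleared from the other kernel vectors by
  -- subtracting suitable multiples of w p.
  module Pivot {m t} (φ : Fin (suc t) → Vec𝔽 F m → Carrier) (linear : ∀ k → IsLinear (φ k))
               (B : KernelBasis (φ ∘ suc)) (p : Fin m) (p-kernel : inKernel B p ≡ true)
               (ψwp≉0 : ¬ (φ zero (w B p) ≈ 0#)) where
    ψ : Vec𝔽 F m → Carrier
    ψ = φ zero

    ψwp⁻¹ : Carrier
    ψwp⁻¹ = proj₁ (inverse (ψ (w B p)) ψwp≉0)

    g : Fin m → Carrier
    g i = ψ (w B i) * ψwp⁻¹

    cleared : Fin m → Vec𝔽 F m
    cleared i l = w B i l - g i * w B p l

    cleared-annihilated : ∀ k i → inKernel B i ≡ true → φ k (cleared i) ≈ 0#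
    cleared-annihilated zero    i _ = trans (linear zero (w B i) (w B p) (g i)) (x≈y⇒x∙y⁻¹≈ε (begin
      ψ (w B i)                          ≈⟨ *-identityʳ _ ⟨
      ψ (w B i) * 1#                     ≈⟨ *-congˡ (proj₂ (inverse (ψ (w B p)) ψwp≉0)) ⟨
      ψ (w B i) * (ψ (w B p) * ψwp⁻¹)    ≈⟨ *-congˡ (*-comm _ _) ⟩
      ψ (w B i) * (ψwp⁻¹ * ψ (w B p))    ≈⟨ *-assoc _ _ _ ⟨
      g i * ψ (w B p)                    ∎))
    cleared-annihilated (suc k) i i-kernel = trans (linear (suc k) (w B i) (w B p) (g i))
      (minus-zeros (g i) (annihilated B k i i-kernel) (annihilated B k p p-kernel))

    inKernel′ : Fin m → Bool
    inKernel′ = updateAt (inKernel B) p (λ _ → false)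

    inKernel′-other : ∀ {i} → i ≢ p → inKernel′ i ≡ inKernel B i
    inKernel′-other {i} i≢p = updateAt-minimal i p (inKernel B) i≢p

    inKernel′-true : ∀ {j} → inKernel′ j ≡ true → j ≢ p × inKernel B j ≡ true
    inKernel′-true {j} j-kernel′ with j ≟ p
    ... | yes ≡.refl = contradiction (≡.trans (≡.sym j-kernel′) (updateAt-updates p (inKernel B))) λ ()
    ... | no  j≢p    = j≢p , ≡.trans (≡.sym (inKernel′-other j≢p)) j-kernel′

    w′-cases : ∀ i → Dec (i ≡ p) → Bool → Vec𝔽 F m
    w′-cases i (yes _) _     = e p
    w′-cases i (no _)  true  = cleared i
    w′-cases i (no _)  false = w B i

    w′ : Fin m → Vec𝔽 F m
    w′ i = w′-cases i (i ≟ p) (inKernel B i)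

    diag′ : ∀ i → w′ i i ≈ 1#
    diag′ i with i ≟ p | inKernel B i in i-sort
    ... | yes ≡.refl | _     = e-diag p
    ... | no  i≢p    | true  =
      trans (minus-scaled-zero (w B i i) (g i) (off-diag B p i (i≢p ∘ ≡.sym) (inj₁ i-sort))) (diag B i)
    ... | no  i≢p    | false = diag B i

    off-diag′ : ∀ i j → i ≢ j → inKernel′ j ≡ true ⊎ inKernel′ i ≡ false → w′ i j ≈ 0#
    off-diag′ i j i≢j sorts with i ≟ p | inKernel B i in i-sort
    ... | yes ≡.refl | _     = e-off p j i≢j
    ... | no  i≢p    | false = off-diag B i j i≢j (inj₂ i-sort)
    ... | no  i≢p    | true  with sorts
    ...   | inj₂ i-pivot′  =
      contradiction (≡.trans (≡.sym i-sort) (≡.trans (≡.sym (inKernel′-other i≢p)) i-pivot′)) λ ()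
    ...   | inj₁ j-kernel′ with inKernel′-true j-kernel′
    ...     | j≢p , j-kernel =
      minus-zeros (g i) (off-diag B i j i≢j (inj₁ j-kernel)) (off-diag B p j (j≢p ∘ ≡.sym) (inj₁ j-kernel))

    annihilated′ : ∀ k i → inKernel′ i ≡ true → φ k (w′ i) ≈ 0#
    annihilated′ k i i-kernel′ with i ≟ p | inKernel B i in i-sort
    ... | yes ≡.refl | _     = contradiction ≡.refl (proj₁ (inKernel′-true i-kernel′))
    ... | no  i≢p    | true  = cleared-annihilated k i i-sort
    ... | no  i≢p    | false = contradiction (≡.trans (≡.sym (proj₂ (inKernel′-true i-kernel′))) i-sort) λ ()

    few-pivots′ : count-false inKernel′ ℕ.≤ suc t
    few-pivots′ rewrite count-false-recolour (inKernel B) p p-kernel = ℕ.s≤s (few-pivots B)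

    basis : KernelBasis φ
    basis = record { w = w′ ; inKernel = inKernel′ ; diag = diag′ ; off-diag = off-diag′
                   ; annihilated = annihilated′ ; few-pivots = few-pivots′ }

  -- Every family of t linear functionals on 𝔽ᵐ has a kernel basis, under a
  -- double negation: each elimination step asks whether the new functional
  -- vanishes on all current kernel vectors, which is not decidable.
  kernel-basis : ∀ {m} t (φ : Fin t → Vec𝔽 F m → Carrier) → (∀ k → IsLinear (φ k)) →
                 ¬ ¬ KernelBasis φ
  kernel-basis {m} zero φ _ k = k record
    { w = e ; inKernel = λ _ → true ; diag = e-diag ; off-diag = λ i j i≢j _ → e-off i j i≢j
    ; annihilated = λ () ; few-pivots = ℕ.≤-reflexive (count-false-const-true m) }
  kernel-basis {m} (suc t) φ linear k = kernel-basis t (φ ∘ suc) (linear ∘ suc) λ B →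
    ¬¬-all-or-counterexample m λ
      { (inj₁ ψ-vanishes)              → k (unchanged B ψ-vanishes)
      ; (inj₂ (p , p-kernel , ψwp≉0)) → k (Pivot.basis φ linear B p p-kernel ψwp≉0) }
    where
    unchanged : (B : KernelBasis (φ ∘ suc)) →
                (∀ i → inKernel B i ≡ true → φ zero (w B i) ≈ 0#) → KernelBasis φ
    unchanged B ψ-vanishes = record
      { w = w B ; inKernel = inKernel B ; diag = diag B ; off-diag = off-diag B
      ; annihilated = λ { zero → ψ-vanishes ; (suc k) → annihilated B k }
      ; few-pivots = ℕ.m≤n⇒m≤1+n (few-pivots B) }

  independent-cong : ∀ {k N} {x y : Fin k → Vec𝔽 F N} → (∀ a j → x a j ≈ y a j) →
                     LinIndep F x → LinIndep F y
  independent-cong x≈y indep a combination≈0 =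
    indep a λ j → trans (sum-cong-≋ λ l → *-congˡ (x≈y l j)) (combination≈0 j)

  Listed : ∀ {N M} → (Fin N → Vec𝔽 F M) → VSet F M
  Listed W x = Lift ℓ (∃ λ l → x ≡ W l)

  -- A set listed by N vectors contains no N + 1 independent vectors, because
  -- two of them would be equal.
  listed-rank-< : ∀ {N M} (W : Fin N → Vec𝔽 F M) → ¬ RankAtLeast F (Listed W) (suc N)
  listed-rank-< {N} W (v , listed , indep) = ℕ.n≮n N (injective⇒≤ index-injective)
    where
    index : Fin (suc N) → Fin N
    index a = proj₁ (lower (listed a))
    index-injective : Injective _≡_ _≡_ index
    index-injective {a} {b} same = independent⇒injective indep a b λ l → reflexive (≡.cong-app va≡vb l)
      where
      va≡vb : v a ≡ v b
      va≡vb = ≡.trans (proj₂ (lower (listed a))) (≡.trans (≡.cong W same) (≡.sym (proj₂ (lower (listed b)))))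

  listed-rank : ∀ {N M} (W : Fin N → Vec𝔽 F M) → LinIndep F W → HasRank F (Listed W) N
  listed-rank W indep = (W , (λ l → lift (l , ≡.refl)) , indep) , listed-rank-< W

module LowerBound {c ℓ : Level} (F : CommutativeRing c ℓ) (isField : IsField F) {n m t : ℕ}
                  (f : Vec𝔽 F (suc n) → Vec𝔽 F m → Vec𝔽 F t) (bilinear : IsBilinear F f) where
  open CommutativeRing F hiding (zero)
  open import Algebra.Properties.Semiring.Sum semiring using (sum)
  open LinearAlgebra F isField
  open KernelBasis
  open ℕ→ℚ-Arithmetic
  open import Data.Rational.Base using (ℚ; 1ℚ) renaming (_≤_ to _≤ℚ_; _<_ to _<ℚ_; _-_ to _-ℚ_; _*_ to _*ℚ_)
  import Data.Rational.Properties as ℚ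

  e₀ : Vec𝔽 F (suc n)
  e₀ = e zero

  φ : Fin t → Vec𝔽 F m → Carrier
  φ k x = sum (λ j → sum (λ l → e₀ j * proj₁ bilinear k j l * x l))

  φ-linear : ∀ k → IsLinear (φ k)
  φ-linear k = sum-of-linear _ λ j → pairing-linear (λ l → e₀ j * proj₁ bilinear k j l)

  f-e₀ : ∀ x k → f e₀ x k ≈ φ k x
  f-e₀ x = proj₂ bilinear e₀ x

  A : VSet F (suc n)
  A = Listed (λ (_ : Fin 1) → e₀)

  A-rank : HasRank F A 1
  A-rank = listed-rank _ (echelon-independent (λ _ → e₀) (λ _ → zero) (λ _ → true) (λ _ → e-diag {suc n} zero)
                                                λ { zero zero 0≢0 → contradiction ≡.refl 0≢0 })

  module _ (basis : KernelBasis φ) where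
    open Split (split (inKernel basis))
    open Listing

    module Test {d r} (d≤K : d ℕ.≤ K) (r≤E : r ℕ.≤ E) where
      kernel-indices : Fin d → Fin m
      kernel-indices i = point trues (inject≤ i d≤K)

      pivot-indices : Fin r → Fin m
      pivot-indices j = point falses (inject≤ j r≤E)

      index : Fin (d ℕ.+ r) → Fin m
      index = kernel-indices ++ pivot-indices

      index-injective : Injective _≡_ _≡_ index
      index-injective = ++-injective _ _
        (λ same → inject≤-injective d≤K d≤K _ _ (point-injective trues same))
        (λ same → inject≤-injective r≤E r≤E _ _ (point-injective falses same))
        λ i j same → contradiction (≡.trans (≡.sym (point-colour trues _))
                                     (≡.trans (≡.cong (inKernel basis) same) (point-colour falses _))) λ ()

      W : Fin (d ℕ.+ r) → Vec𝔽 F m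
      W = w basis ∘ index

      B : VSet F m
      B = Listed W

      B-rank : HasRank F B (d ℕ.+ r)
      B-rank = listed-rank W (echelon-independent W index (inKernel basis ∘ index) (diag basis ∘ index)
                               λ a b a≢b → off-diag basis (index a) (index b) (a≢b ∘ index-injective))

      kernel-part : ∀ i k → φ k (W (i ↑ˡ r)) ≈ 0#
      kernel-part i k = annihilated basis k (index (i ↑ˡ r))
        (≡.trans (≡.cong (inKernel basis) (lookup-++ˡ kernel-indices pivot-indices i)) (point-colour trues _))

      -- An independent family in f(A × B) consists of images of distinct pivot
      -- vectors, hence has at most r members.
      image-rank≤ : ∀ {k} → ImageRankAtLeast F f A B k → k ℕ.≤ r
      image-rank≤ {k} (vs , ws , vs∈A , ws∈B , indep) = injective⇒≤ {f = pivot} pivot-injective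
        where
        b : Fin k → Fin (d ℕ.+ r)
        b a = proj₁ (lower (ws∈B a))

        image : ∀ a j → f (vs a) (ws a) j ≈ φ j (W (b a))
        image a j = trans (reflexive (≡.cong-app (≡.cong₂ f (proj₂ (lower (vs∈A a))) (proj₂ (lower (ws∈B a)))) j))
                          (f-e₀ (W (b a)) j)

        indep′ : LinIndep F (λ a j → φ j (W (b a)))
        indep′ = independent-cong image indep

        pivot-block : ∀ a → ∃ λ q → d ↑ʳ q ≡ b a
        pivot-block a with block d (b a)
        ... | inj₂ right = right
        ... | inj₁ (i , i↑ˡr≡ba) = ⊥-elim (independent⇒nonzero indep′ a λ j →
                                      trans (reflexive (≡.cong (λ l → φ j (W l)) (≡.sym i↑ˡr≡ba))) (kernel-part i j))

        pivot : Fin k → Fin r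
        pivot a = proj₁ (pivot-block a)

        pivot-injective : Injective _≡_ _≡_ pivot
        pivot-injective {a} {a′} same = independent⇒injective indep′ a a′ λ j →
          reflexive (≡.cong (λ l → φ j (W l)) (≡.trans (≡.sym (proj₂ (pivot-block a)))
                                              (≡.trans (≡.cong (d ↑ʳ_) same) (proj₂ (pivot-block a′)))))

      condensed : ∀ {s ε} → IsTwoSourceRankCondenser F f 1 s ε → d ℕ.+ r ≡ s →
                  (1ℚ -ℚ ε) *ℚ ℕ→ℚ 1 *ℚ ℕ→ℚ s ≤ℚ ℕ→ℚ r
      condensed condenser d+r≡s with condenser A B A-rank (≡.subst (HasRank F B) d+r≡s B-rank)
      ... | k , bound , image = ℚ.≤-trans bound (ℕ→ℚ-mono-≤ (image-rank≤ image))

    -- Testing with min(K, s) kernel vectors and s ∸ K ≤ E pivot vectors gives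
    -- (1 − ε)s ≤ s ∸ K, while m = K + E ≤ K + t.
    lower-bound : ∀ {s ε} → ε <ℚ 1ℚ → 1 ℕ.≤ s → s ℕ.≤ m → IsTwoSourceRankCondenser F f 1 s ε →
                  ℕ→ℚ m -ℚ ε *ℚ ℕ→ℚ s ≤ℚ ℕ→ℚ t
    lower-bound {s} {ε} ε<1 1≤s s≤m condenser = condensing-arithmetic ε m s K t ε<1 1≤s
      (Test.condensed (ℕ.m⊓n≤m K s) s∸K≤E {s} {ε} condenser (ℕ.m⊓n+n∸m≡n K s)) m≤K+t
      where
      s∸K≤E : s ∸ K ℕ.≤ E
      s∸K≤E = ℕ.m≤n+o⇒m∸n≤o s K (≡.subst (s ℕ.≤_) (≡.sym K+E≡m) s≤m)
      m≤K+t : m ℕ.≤ K ℕ.+ t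
      m≤K+t = ≡.subst (ℕ._≤ K ℕ.+ t) K+E≡m
                (ℕ.+-monoʳ-≤ K (≡.subst (ℕ._≤ t) (≡.sym E≡count) (few-pivots basis)))

-- Imported only here: these names clash with the ring operations used above.
open import Data.Nat.Base using (_≤_)
open import Data.Rational.Base using (ℚ; _<_; _-_; _*_; 1ℚ) renaming (_≤_ to _≤ℚ_)
open import Data.Rational.Properties using (_≤?_)

-- Proposition 9.4.  The kernel basis exists only under a double negation, which
-- is removed because the conclusion is a decidable inequality of rationals.
proposition9p4 : ∀ {c ℓ : Level} (F : CommutativeRing c ℓ) → IsField F →
                 (n m s t : ℕ) (ε : ℚ) → 1 ≤ n → 1 ≤ s → s ≤ m → ε < 1ℚ →
                 (f : Vec𝔽 F n → Vec𝔽 F m → Vec𝔽 F t) →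
                 IsBilinear F f → IsTwoSourceRankCondenser F f 1 s ε →
                 (ℕ→ℚ m - ε * ℕ→ℚ s) ≤ℚ ℕ→ℚ t
proposition9p4 F isField (suc n) m s t ε _ 1≤s s≤m ε<1 f bilinear condenser =
  decidable-stable (_ ≤? _) λ ¬bound →
    kernel-basis t φ φ-linear λ basis → ¬bound (lower-bound basis ε<1 1≤s s≤m condenser)
  where
  open LinearAlgebra F isField using (kernel-basis)
  open LowerBound F isField f bilinear using (φ; φ-linear; lower-bound)
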